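{- Let $q$ be a prime with $q\equiv 3 \pmod 4$ and $m\ge 1$ an integer. Then the zero-divisor graph $\Gamma(\mathbb{Z}_{q^m}[i])$ is pancyclic if and only if $m=2$.
   Context: $\mathbb{Z}_n[i]=\mathbb{Z}[i]/\langle n\rangle=\{a+bi : a,b\in\mathbb{Z}_n\}$ with $i^2=-1$. For a finite commutative ring $R$ with unity, $\Gamma(R)$ has vertex set the nonzero zero-divisors of $R$, distinct $x,y$ adjacent iff $xy=0$. A graph of order $N$ is pancyclic if $N\ge 3$ and it contains a cycle of length $k$ for every $3\le k\le N$. -}

module Defs where

open import Data.Nat using (ℕ; suc; _^_; _≤_; _<_)
open import Data.Integer as ℤ using (ℤ; +_)
open import Data.Integer.Divisibility using (_∣_)
open import Data.Fin using (Fin; toℕ)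
open import Data.Product using (_×_; _,_; Σ; ∃-syntax)
open import Data.Vec using (Vec; lookup)
open import Relation.Binary.PropositionalEquality using (_≡_)
open import Relation.Nullary using (¬_)
open import Function.Definitions using (Injective)

-- The ring Z_n[i] = {a + b i : a, b ∈ Z_n}, i^2 = -1; an element a + b i is
-- represented by the pair (a , b) of residues in Fin n = {0, ..., n-1}.
ZnI : ℕ → Set
ZnI n = Fin n × Fin n

re im : ∀ {n} → ZnI n → ℤ
re (a , _) = + toℕ a
im (_ , b) = + toℕ b

IsZero : ∀ {n} → ZnI n → Set
IsZero {n} x = (+ n ∣ re x) × (+ n ∣ im x)

-- the product x * y is zero in Z_n[i]:
-- (a + b i)(c + d i) = (ac - bd) + (ad + bc) i, computed modulo n
MulZero : ∀ {n} → ZnI n → ZnI n → Set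
MulZero {n} x y =
  (+ n ∣ (re x ℤ.* re y ℤ.- im x ℤ.* im y)) ×
  (+ n ∣ (re x ℤ.* im y ℤ.+ im x ℤ.* re y))

IsVertex : ∀ {n} → ZnI n → Set
IsVertex {n} x = ¬ IsZero x × Σ (ZnI n) (λ y → ¬ IsZero y × MulZero x y)

HasOrder : ℕ → ℕ → Set
HasOrder n N =
  Σ (Fin N → ZnI n) λ e →
    Injective _≡_ _≡_ e × (∀ i → IsVertex (e i)) ×
    (∀ x → IsVertex x → ∃[ i ] e i ≡ x)

HasCycle : ℕ → ℕ → Set
HasCycle n k =
  Σ (ℕ → ZnI n) λ v →
    (∀ j → j < k → IsVertex (v j)) ×
    (∀ i j → i < k → j < k → v i ≡ v j → i ≡ j) ×
    (∀ j → j < k → ¬ (v j ≡ v (suc j)) × MulZero (v j) (v (suc j))) ×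
    (v k ≡ v 0)

Pancyclic : ℕ → Set
Pancyclic n = Σ ℕ λ N → HasOrder n N × 3 ≤ N × (∀ k → 3 ≤ k → k ≤ N → HasCycle n k)

module Submission where

-- Write q = p = 3 + 4r.  Since -1 is not a square modulo p (Fermat's little
-- theorem, proved here from the binomial theorem of the library), p ∣ a² + b²
-- forces p ∣ a and p ∣ b.  Multiplying by the conjugate then shows that the
-- zero-divisors of Z_{p^m}[i] are exactly the nonzero elements with both
-- coordinates divisible by p.  Hence
--   * m = 1: there are no vertices at all;
--   * m = 2: the p² - 1 vertices p·(s + t i) pairwise multiply to 0, so Γ is
--     complete, and complete graphs of order ≥ 3 are pancyclic;
--   * m ≥ 3: the K² vertices p·((1 + p s) + p t i), K = p^(m-2), are p times a
--     unit, so all their neighbours are divisible by p²; there are only K² - 1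
--     nonzero such elements, while a Hamiltonian cycle would give those K²
--     vertices K² distinct successors among them.

open import Defs
open import Data.Nat
open import Data.Nat.Properties
open import Data.Nat.Divisibility
open import Data.Nat.DivMod using (_%_; _/_; m%n<n; m<n⇒m%n≡m; n%n≡0; m≡m%n+[m/n]*n)
open import Data.Nat.Primality using (Prime; euclidsLemma; prime⇒nonZero)
open import Data.Nat.Combinatorics using (_C_; nCn≡1; nC1≡n; nCk+nC[k+1]≡[n+1]C[k+1])
open import Data.Nat.Tactic.RingSolver using (solve-∀)
open import Data.Integer as ℤ using (+_)
import Data.Integer.Properties as ℤP
open import Data.Integer.Divisibility using () renaming (_∣_ to _∣ᵤ_)
open import Data.Integer.Divisibility.Signed as ℤ∣ using () renaming (_∣_ to _∣ℤ_)
open import Data.Integer.Tactic.RingSolver using () renaming (solve-∀ to solve-∀ℤ)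
open import Data.Fin as F using (Fin; toℕ; fromℕ<; combine; remQuot)
import Data.Fin.Properties as FP
open import Data.Product
open import Data.Sum
open import Data.Empty
open import Data.Vec.Functional using (Vector; init; last; tail)
open import Function using (_∘_)
open import Function.Definitions using (Injective)
open import Function.Bundles using (_⇔_; mk⇔)
open import Relation.Nullary using (¬_; Dec; yes; no)
open import Relation.Nullary.Decidable using (decidable-stable)
open import Relation.Binary.PropositionalEquality
open import Algebra.Bundles using (CommutativeSemiring)
import Algebra.Properties.CommutativeSemiring.Binomial +-*-commutativeSemiring as Binomial
import Algebra.Properties.Semiring.Exp (CommutativeSemiring.semiring +-*-commutativeSemiring) as SemiringExp
import Algebra.Definitions.RawMonoid +-0-rawMonoid as AdditiveMult
open import Algebra.Definitions.RawMonoid +-0-rawMonoid using (sum)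
import Algebra.Properties.Monoid.Sum +-0-monoid as Sum
open ≡-Reasoning

euclidˡ : ∀ {p} a b → Prime p → ¬ p ∣ a → p ∣ a * b → p ∣ b
euclidˡ a b pr p∤a p∣ab with euclidsLemma a b pr p∣ab
... | inj₁ p∣a = ⊥-elim (p∤a p∣a)
... | inj₂ p∣b = p∣b

absorption : ∀ n k → suc k * (suc n C suc k) ≡ suc n * (n C k)
absorption zero zero = refl
absorption zero (suc k) = *-zeroʳ (2 + k)
absorption (suc n) zero = begin
  1 * (suc (suc n) C 1) ≡⟨ *-identityˡ _ ⟩
  suc (suc n) C 1       ≡⟨ nC1≡n (suc (suc n)) ⟩
  suc (suc n)           ≡⟨ *-identityʳ (suc (suc n)) ⟨
  suc (suc n) * 1       ∎
absorption (suc n) (suc k) = begin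
  (2 + k) * ((2 + n) C (2 + k))
    ≡⟨ cong ((2 + k) *_) (nCk+nC[k+1]≡[n+1]C[k+1] (suc n) (suc k)) ⟨
  (2 + k) * (X + Y)
    ≡⟨ regroup k X Y ⟩
  X + (suc k * X + (2 + k) * Y)
    ≡⟨ cong₂ (λ u v → X + (u + v)) (absorption n k) (absorption n (suc k)) ⟩
  X + (suc n * (n C k) + suc n * (n C suc k))
    ≡⟨ cong (_+_ X) (*-distribˡ-+ (suc n) (n C k) (n C suc k)) ⟨
  X + suc n * (n C k + n C suc k)
    ≡⟨ cong (λ u → X + suc n * u) (nCk+nC[k+1]≡[n+1]C[k+1] n k) ⟩
  (2 + n) * X ∎
  where
  X = suc n C suc k
  Y = suc n C (2 + k)
  regroup : ∀ k X Y → (2 + k) * (X + Y) ≡ X + (suc k * X + (2 + k) * Y)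
  regroup = solve-∀

prime∣binomial : ∀ {p} → Prime p → ∀ k → 0 < k → k < p → p ∣ p C k
prime∣binomial {suc p-1} pr (suc j) _ k<p = euclidˡ (suc j) (suc p-1 C suc j) pr p∤k
  (divides (p-1 C j) (trans (absorption p-1 j) (*-comm (suc p-1) (p-1 C j))))
  where
  p∤k : ¬ suc p-1 ∣ suc j
  p∤k p∣k = <⇒≱ k<p (∣⇒≤ p∣k)

-- The power and the scalar multiple defined generically for semirings agree,
-- on ℕ, with ℕ's own; needed to read the library's binomial theorem in ℕ.
genericPower : ∀ x k → x SemiringExp.^ k ≡ x ^ k
genericPower x zero = refl
genericPower x (suc k) = cong (x *_) (genericPower x k)

genericMultiple : ∀ k x → k AdditiveMult.× x ≡ k * x
genericMultiple zero x = refl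
genericMultiple (suc k) x = cong (_+_ x) (genericMultiple k x)

∣-sum : ∀ {d n} (t : Vector ℕ n) → (∀ i → d ∣ t i) → d ∣ sum t
∣-sum {d} {zero} t _ = d ∣0
∣-sum {n = suc n} t d∣t = ∣m∣n⇒∣m+n (d∣t F.zero) (∣-sum (tail t) (d∣t ∘ F.suc))

-- Freshman's dream: (a + 1)^p ≡ 1 + a^p modulo a prime p.  In the binomial
-- expansion the extreme terms are 1 and a^p and every inner term
-- C(p,k) a^k is a multiple of p.
freshman : ∀ {p} → Prime p → ∀ a → ∃ λ M → (a + 1) ^ p ≡ 1 + M * p + a ^ p
freshman {suc p-1} pr a = quotient inner , (begin
  (a + 1) ^ p
    ≡⟨ genericPower (a + 1) p ⟨
  (a + 1) SemiringExp.^ p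
    ≡⟨ Binomial.theorem p a 1 ⟩
  term F.zero + sum (tail term)
    ≡⟨ cong (_+_ (term F.zero)) (Sum.sum-init-last (tail term)) ⟩
  term F.zero + (sum (init (tail term)) + last (tail term))
    ≡⟨ cong₂ (λ u v → u + (v + last (tail term))) firstTerm (_∣_.equality inner) ⟩
  1 + (quotient inner * p + last (tail term))
    ≡⟨ cong (λ v → 1 + (quotient inner * p + v)) lastTerm ⟩
  1 + (quotient inner * p + a ^ p)
    ≡⟨ +-assoc 1 (quotient inner * p) (a ^ p) ⟨
  1 + quotient inner * p + a ^ p ∎)
  where
  p = suc p-1
  term : Vector ℕ (suc p)
  term i = (p C toℕ i) AdditiveMult.× (a SemiringExp.^ toℕ i * 1 SemiringExp.^ (p ∸ toℕ i))
  termValue : ∀ i → term i ≡ (p C toℕ i) * a ^ toℕ i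
  termValue i = begin
    term i
      ≡⟨ genericMultiple (p C k) _ ⟩
    (p C k) * (a SemiringExp.^ k * 1 SemiringExp.^ (p ∸ k))
      ≡⟨ cong₂ (λ u v → (p C k) * (u * v)) (genericPower a k) (genericPower 1 (p ∸ k)) ⟩
    (p C k) * (a ^ k * 1 ^ (p ∸ k))
      ≡⟨ cong (λ v → (p C k) * (a ^ k * v)) (^-zeroˡ (p ∸ k)) ⟩
    (p C k) * (a ^ k * 1)
      ≡⟨ cong ((p C k) *_) (*-identityʳ (a ^ k)) ⟩
    (p C k) * a ^ k ∎
    where k = toℕ i
  firstTerm : term F.zero ≡ 1
  firstTerm = termValue F.zero
  lastTerm : last (tail term) ≡ a ^ p
  lastTerm = begin
    last (tail term)                 ≡⟨ termValue (F.fromℕ p) ⟩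
    (p C toℕ (F.fromℕ p)) * a ^ toℕ (F.fromℕ p)
      ≡⟨ cong (λ k → (p C k) * a ^ k) (FP.toℕ-fromℕ p) ⟩
    (p C p) * a ^ p                  ≡⟨ cong (_* a ^ p) (nCn≡1 p) ⟩
    1 * a ^ p                        ≡⟨ *-identityˡ (a ^ p) ⟩
    a ^ p ∎
  innerTerm : ∀ i → p ∣ init (tail term) i
  innerTerm i = subst (p ∣_) (sym (termValue (F.suc (F.inject₁ i))))
    (∣m⇒∣m*n _ (prime∣binomial pr (suc (toℕ (F.inject₁ i))) (s≤s z≤n)
      (s≤s (subst (_< p-1) (sym (FP.toℕ-inject₁ i)) (FP.toℕ<n i)))))
  inner : p ∣ sum (init (tail term))
  inner = ∣-sum (init (tail term)) innerTerm

fermat : ∀ {p} → Prime p → ∀ a → ∃ λ M → a ^ p ≡ a + M * p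
fermat {suc p-1} pr zero = 0 , refl
fermat {p} pr (suc a) with freshman pr a | fermat pr a
... | M₁ , step | M₂ , hyp = M₁ + M₂ , (begin
  suc a ^ p                   ≡⟨ cong (_^ p) (+-comm 1 a) ⟩
  (a + 1) ^ p                 ≡⟨ step ⟩
  1 + M₁ * p + a ^ p          ≡⟨ cong (_+_ (1 + M₁ * p)) hyp ⟩
  1 + M₁ * p + (a + M₂ * p)   ≡⟨ collect a M₁ M₂ p ⟩
  suc a + (M₁ + M₂) * p       ∎)
  where
  collect : ∀ a M₁ M₂ p → 1 + M₁ * p + (a + M₂ * p) ≡ suc a + (M₁ + M₂) * p
  collect = solve-∀

-- Euler's form of Fermat's theorem: a^(p-1) ≡ 1 (mod p) when p ∤ a, obtained
-- by cancelling a from a · a^(p-1) ≡ a.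
fermatUnit : ∀ {n} → Prime (suc n) → ∀ a → ¬ suc n ∣ a → ∃ λ K → a ^ n ≡ 1 + K * suc n
fermatUnit {n} pr zero p∤a = ⊥-elim (p∤a (suc n ∣0))
fermatUnit {n} pr a@(suc _) p∤a = quotient p∣c , (begin
  a ^ n                 ≡⟨ a^n≡1+c ⟩
  1 + c                 ≡⟨ cong suc (_∣_.equality p∣c) ⟩
  1 + quotient p∣c * suc n ∎)
  where
  c = a ^ n ∸ 1
  a^n≡1+c : a ^ n ≡ 1 + c
  a^n≡1+c = sym (m+[n∸m]≡n (m^n>0 a n))
  M = proj₁ (fermat pr a)
  a*c≡M*p : a * c ≡ M * suc n
  a*c≡M*p = +-cancelˡ-≡ a _ _ (begin
    a + a * c        ≡⟨ *-suc a c ⟨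
    a * (1 + c)      ≡⟨ cong (a *_) a^n≡1+c ⟨
    a ^ suc n        ≡⟨ proj₂ (fermat pr a) ⟩
    a + M * suc n    ∎)
  p∣c : suc n ∣ c
  p∣c = euclidˡ a c pr p∤a (divides M a*c≡M*p)

primePowerCancel : ∀ {p} m s c → Prime p → ¬ p ∣ s → p ^ m ∣ s * c → p ^ m ∣ c
primePowerCancel zero s c _ _ _ = 1∣ c
primePowerCancel {p} (suc m) s c pr p∤s p^[m+1]∣sc
  with euclidˡ s c pr p∤s (∣-trans (m∣m*n (p ^ m)) p^[m+1]∣sc)
... | divides c′ refl = subst (p ^ suc m ∣_) (*-comm p c′)
  (*-monoʳ-∣ p (primePowerCancel m s c′ pr p∤s
    (*-cancelˡ-∣ p (subst (p * p ^ m ∣_) (rearrange s c′ p) p^[m+1]∣sc))))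
  where
  instance _ = prime⇒nonZero pr
  rearrange : ∀ s c p → s * (c * p) ≡ p * (s * c)
  rearrange = solve-∀

-- If A ≡ -1 (mod d) then every odd power of A is ≡ -1 (mod d), because
-- A(A+1) + (A²·A^(2k+1) + 1) = A²(A^(2k+1) + 1) + (A+1).
oddPower : ∀ {d} A k → d ∣ A + 1 → d ∣ A ^ (1 + k * 2) + 1
oddPower A zero d∣A+1 = subst (λ x → _ ∣ x + 1) (sym (*-identityʳ A)) d∣A+1
oddPower {d} A (suc k) d∣A+1 = ∣m+n∣m⇒∣n
  (subst (d ∣_) (sym (regroup A (A ^ (1 + k * 2))))
    (∣m∣n⇒∣m+n (∣n⇒∣m*n (A * A) (oddPower A k d∣A+1)) d∣A+1))
  (∣n⇒∣m*n A d∣A+1)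
  where
  regroup : ∀ A Y → A * (A + 1) + (A * (A * Y) + 1) ≡ A * A * (Y + 1) + (A + 1)
  regroup = solve-∀

-- Pigeonhole principle: an injective map from Fin M to itself hits every
-- element (otherwise sending 0 to the missed value and i+1 to f i would give
-- an injection Fin (M + 1) → Fin M).
injective⇒surjective : ∀ {M} (f : Fin M → Fin M) → Injective _≡_ _≡_ f → ∀ z → ∃ λ i → f i ≡ z
injective⇒surjective {M} f f-inj z with FP.any? (λ i → f i FP.≟ z)
... | yes hit = hit
... | no miss = ⊥-elim (1+n≰n (FP.injective⇒≤ g-inj))
  where
  g : Fin (suc M) → Fin M
  g F.zero = z
  g (F.suc i) = f i
  g-inj : Injective _≡_ _≡_ g
  g-inj {F.zero} {F.zero} _ = refl
  g-inj {F.zero} {F.suc j} z≡fj = ⊥-elim (miss (j , sym z≡fj))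
  g-inj {F.suc i} {F.zero} fi≡z = ⊥-elim (miss (i , fi≡z))
  g-inj {F.suc i} {F.suc j} fi≡fj = cong F.suc (f-inj fi≡fj)

completePancyclic : ∀ {n N} → HasOrder n N → 3 ≤ N →
  (∀ x y → IsVertex x → IsVertex y → MulZero x y) → Pancyclic n
completePancyclic {n} {N} order@(e , e-inj , e-vertex , _) 3≤N adjacent = N , order , 3≤N , cycle
  where
  cycle : ∀ k → 3 ≤ k → k ≤ N → HasCycle n k
  cycle k@(suc k-1) 3≤k k≤N = v , (λ j _ → e-vertex (index j)) , distinct , edge , closed
    where
    index : ℕ → Fin N
    index j = fromℕ< (<-≤-trans (m%n<n j k) k≤N)
    v : ℕ → ZnI n
    v j = e (index j)
    sameResidue : ∀ i j → v i ≡ v j → i % k ≡ j % k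
    sameResidue i j vi≡vj = FP.fromℕ<-injective _ _ _ _ (e-inj vi≡vj)
    distinct : ∀ i j → i < k → j < k → v i ≡ v j → i ≡ j
    distinct i j i<k j<k vi≡vj = begin
      i      ≡⟨ m<n⇒m%n≡m i<k ⟨
      i % k  ≡⟨ sameResidue i j vi≡vj ⟩
      j % k  ≡⟨ m<n⇒m%n≡m j<k ⟩
      j      ∎
    closed : v k ≡ v 0
    closed = cong e (FP.fromℕ<-cong _ _ (n%n≡0 k) _ _)
    -- consecutive vertices differ: for j + 1 < k by distinctness, and for
    -- j + 1 = k because v k = v 0 while j = k - 1 ≥ 2
    consecutiveDistinct : ∀ j → j < k → v j ≢ v (suc j)
    consecutiveDistinct j j<k vj≡vj+1 with m≤n⇒m<n∨m≡n j<k
    ... | inj₁ j+1<k = 1+n≢n (sym (distinct j (suc j) j<k j+1<k vj≡vj+1))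
    ... | inj₂ j+1≡k = 3≰1 (subst (3 ≤_) (trans (sym j+1≡k) (cong suc j≡0)) 3≤k)
      where
      j≡0 : j ≡ 0
      j≡0 = distinct j 0 j<k (<-≤-trans (s≤s z≤n) 3≤k)
        (trans vj≡vj+1 (trans (cong v j+1≡k) closed))
      3≰1 : ¬ 3 ≤ 1
      3≰1 (s≤s ())
    edge : ∀ j → j < k → v j ≢ v (suc j) × MulZero (v j) (v (suc j))
    edge j j<k = consecutiveDistinct j j<k ,
      adjacent (v j) (v (suc j)) (e-vertex (index j)) (e-vertex (index (suc j)))

-- A Hamiltonian cycle passes through every vertex: locating its N distinct
-- vertices in the enumeration gives an injective, hence surjective, map
-- Fin N → Fin N.
cycleCovers : ∀ {n N} → HasOrder n N → (cycle : HasCycle n N) →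
  ∀ x → IsVertex x → Σ (Fin N) λ j → proj₁ cycle (toℕ j) ≡ x
cycleCovers {N = N} (e , _ , _ , e-onto) (v , v-vertex , v-distinct , _) x hx =
  j , (begin
    v (toℕ j)                ≡⟨ e∘label j ⟨
    e (label j)              ≡⟨ cong e label-j≡i ⟩
    e (proj₁ (e-onto x hx))  ≡⟨ proj₂ (e-onto x hx) ⟩
    x                        ∎)
  where
  label : Fin N → Fin N
  label j = proj₁ (e-onto (v (toℕ j)) (v-vertex _ (FP.toℕ<n j)))
  e∘label : ∀ j → e (label j) ≡ v (toℕ j)
  e∘label j = proj₂ (e-onto (v (toℕ j)) (v-vertex _ (FP.toℕ<n j)))
  label-injective : Injective _≡_ _≡_ label
  label-injective {i} {j} li≡lj = FP.toℕ-injective (v-distinct _ _ (FP.toℕ<n i) (FP.toℕ<n j)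
    (trans (sym (e∘label i)) (trans (cong e li≡lj) (e∘label j))))
  j = proj₁ (injective⇒surjective label label-injective (proj₁ (e-onto x hx)))
  label-j≡i = proj₂ (injective⇒surjective label label-injective (proj₁ (e-onto x hx)))

hamiltonianSuccessor : ∀ {n N} → HasOrder n N → HasCycle n N →
  Σ ((x : ZnI n) → IsVertex x → ZnI n) λ next →
    (∀ x (hx : IsVertex x) → IsVertex (next x hx) × MulZero x (next x hx)) ×
    (∀ x y (hx : IsVertex x) (hy : IsVertex y) → next x hx ≡ next y hy → x ≡ y)
hamiltonianSuccessor {n} {N} order cycle@(v , v-vertex , v-distinct , v-edge , v-closed) =
  next , (λ x hx → next-vertex x hx , next-adjacent x hx) , next-injective
  where
  position : ∀ x → IsVertex x → Fin N
  position x hx = proj₁ (cycleCovers order cycle x hx)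
  v∘position : ∀ x hx → v (toℕ (position x hx)) ≡ x
  v∘position x hx = proj₂ (cycleCovers order cycle x hx)
  next : ∀ x → IsVertex x → ZnI n
  next x hx = v (suc (toℕ (position x hx)))
  next-vertex : ∀ x hx → IsVertex (next x hx)
  next-vertex x hx with m≤n⇒m<n∨m≡n (FP.toℕ<n (position x hx))
  ... | inj₁ j+1<N = v-vertex _ j+1<N
  ... | inj₂ j+1≡N = subst IsVertex (sym (trans (cong v j+1≡N) v-closed))
                       (v-vertex 0 (<-≤-trans z<s (FP.toℕ<n (position x hx))))
  next-adjacent : ∀ x hx → MulZero x (next x hx)
  next-adjacent x hx = subst (λ y → MulZero y (next x hx)) (v∘position x hx)
    (proj₂ (v-edge _ (FP.toℕ<n (position x hx))))
  -- the successor index j + 1 is read cyclically (v N = v 0), so it determines j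
  successor-distinct : ∀ i j → i < N → j < N → v (suc i) ≡ v (suc j) → i ≡ j
  successor-distinct i j i<N j<N eq with m≤n⇒m<n∨m≡n i<N | m≤n⇒m<n∨m≡n j<N
  ... | inj₁ i+1<N | inj₁ j+1<N = suc-injective (v-distinct _ _ i+1<N j+1<N eq)
  ... | inj₁ i+1<N | inj₂ j+1≡N = ⊥-elim (1+n≢0 (v-distinct _ 0 i+1<N (<-≤-trans z<s j<N)
          (trans eq (trans (cong v j+1≡N) v-closed))))
  ... | inj₂ i+1≡N | inj₁ j+1<N = ⊥-elim (1+n≢0 (v-distinct _ 0 j+1<N (<-≤-trans z<s i<N)
          (trans (sym eq) (trans (cong v i+1≡N) v-closed))))
  ... | inj₂ i+1≡N | inj₂ j+1≡N = suc-injective (trans i+1≡N (sym j+1≡N))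
  next-injective : ∀ x y hx hy → next x hx ≡ next y hy → x ≡ y
  next-injective x y hx hy eq = begin
    x                          ≡⟨ v∘position x hx ⟨
    v (toℕ (position x hx))    ≡⟨ cong v (successor-distinct _ _ (FP.toℕ<n (position x hx)) (FP.toℕ<n (position y hy)) eq) ⟩
    v (toℕ (position y hy))    ≡⟨ v∘position y hy ⟩
    y                          ∎

∣⇒∣ℤ : ∀ {n} a c → n ∣ a * c → + n ∣ℤ + a ℤ.* + c
∣⇒∣ℤ {n} a c n∣ac = ℤ∣.∣ᵤ⇒∣ (subst (n ∣_) (sym (ℤP.abs-* (+ a) (+ c))) n∣ac)

∣ℤ⇒∣ : ∀ {n} a c → + n ∣ℤ + a ℤ.* + c → n ∣ a * c
∣ℤ⇒∣ {n} a c n∣ac = subst (n ∣_) (ℤP.abs-* (+ a) (+ c)) (ℤ∣.∣⇒∣ᵤ n∣ac)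

productsDivisible⇒mulZero : ∀ {n} (a b c d : Fin n) →
  n ∣ toℕ a * toℕ c → n ∣ toℕ b * toℕ d → n ∣ toℕ a * toℕ d → n ∣ toℕ b * toℕ c →
  MulZero (a , b) (c , d)
productsDivisible⇒mulZero a b c d ac bd ad bc =
  ℤ∣.∣⇒∣ᵤ (ℤ∣.∣m∣n⇒∣m-n (∣⇒∣ℤ (toℕ a) (toℕ c) ac) (∣⇒∣ℤ (toℕ b) (toℕ d) bd)) ,
  ℤ∣.∣⇒∣ᵤ (ℤ∣.∣m∣n⇒∣m+n (∣⇒∣ℤ (toℕ a) (toℕ d) ad) (∣⇒∣ℤ (toℕ b) (toℕ c) bc))

-- Multiplying by the conjugate: if (a + b i)(c + d i) ≡ 0 (mod n) then the
-- norm a² + b² annihilates c + d i, i.e. n ∣ (a² + b²)·c and n ∣ (a² + b²)·d.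
normAnnihilates : ∀ {n} a b c d →
  + n ∣ℤ + a ℤ.* + c ℤ.- + b ℤ.* + d → + n ∣ℤ + a ℤ.* + d ℤ.+ + b ℤ.* + c →
  n ∣ (a * a + b * b) * c × n ∣ (a * a + b * b) * d
normAnnihilates a b c d n∣re n∣im =
  ∣ℤ⇒∣ (a * a + b * b) c (subst (_ ∣ℤ_) (sym (trans (cong (ℤ._* + c) normℤ) (conjugateRe (+ a) (+ b) (+ c) (+ d))))
    (ℤ∣.∣m∣n⇒∣m+n (ℤ∣.∣n⇒∣m*n (+ a) n∣re) (ℤ∣.∣n⇒∣m*n (+ b) n∣im))) ,
  ∣ℤ⇒∣ (a * a + b * b) d (subst (_ ∣ℤ_) (sym (trans (cong (ℤ._* + d) normℤ) (conjugateIm (+ a) (+ b) (+ c) (+ d))))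
    (ℤ∣.∣m∣n⇒∣m-n (ℤ∣.∣n⇒∣m*n (+ a) n∣im) (ℤ∣.∣n⇒∣m*n (+ b) n∣re)))
  where
  normℤ : + (a * a + b * b) ≡ + a ℤ.* + a ℤ.+ + b ℤ.* + b
  normℤ = trans (ℤP.pos-+ (a * a) (b * b)) (cong₂ ℤ._+_ (ℤP.pos-* a a) (ℤP.pos-* b b))
  conjugateRe : ∀ x y z w → (x ℤ.* x ℤ.+ y ℤ.* y) ℤ.* z ≡ x ℤ.* (x ℤ.* z ℤ.- y ℤ.* w) ℤ.+ y ℤ.* (x ℤ.* w ℤ.+ y ℤ.* z)
  conjugateRe = solve-∀ℤ
  conjugateIm : ∀ x y z w → (x ℤ.* x ℤ.+ y ℤ.* y) ℤ.* w ≡ x ℤ.* (x ℤ.* w ℤ.+ y ℤ.* z) ℤ.- y ℤ.* (x ℤ.* z ℤ.- y ℤ.* w)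
  conjugateIm = solve-∀ℤ

residueDivisible⇒zero : ∀ {n} (c : Fin n) → n ∣ toℕ c → toℕ c ≡ 0
residueDivisible⇒zero c n∣c with toℕ c | FP.toℕ<n c
... | zero | _ = refl
... | suc k | k<n = ⊥-elim (<⇒≱ k<n (∣⇒≤ n∣c))

-- For p > 1 and m ≥ 1, every nonzero x ∈ Z_{p^m}[i] with p ∣ re x and
-- p ∣ im x is a zero-divisor: x · p^(m-1) = 0 while p^(m-1) ≢ 0.
divisible⇒vertex : ∀ {p} → 1 < p → ∀ m (x : ZnI (p ^ suc m)) →
  p ∣ toℕ (proj₁ x) → p ∣ toℕ (proj₂ x) → ¬ IsZero x → IsVertex x
divisible⇒vertex {p} 1<p m (a , b) p∣a p∣b x≢0 =
  x≢0 , (c , z) , y≢0 ,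
  productsDivisible⇒mulZero a b c z
    (subst (λ v → n ∣ toℕ a * v) (sym toℕc) (timesPower p∣a))
    (subst (λ v → n ∣ toℕ b * v) (sym toℕz) (annihilated (toℕ b)))
    (subst (λ v → n ∣ toℕ a * v) (sym toℕz) (annihilated (toℕ a)))
    (subst (λ v → n ∣ toℕ b * v) (sym toℕc) (timesPower p∣b))
  where
  n = p ^ suc m
  p^m<n : p ^ m < n
  p^m<n = ^-monoʳ-< p 1<p (n<1+n m)
  c z : Fin n
  c = fromℕ< p^m<n
  z = fromℕ< (≤-<-trans z≤n p^m<n)
  toℕc : toℕ c ≡ p ^ m
  toℕc = FP.toℕ-fromℕ< p^m<n
  toℕz : toℕ z ≡ 0
  toℕz = FP.toℕ-fromℕ< (≤-<-trans z≤n p^m<n)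
  instance
    p≢0 : NonZero p
    p≢0 = >-nonZero (<-trans z<s 1<p)
    p^m≢0 : NonZero (p ^ m)
    p^m≢0 = >-nonZero (m^n>0 p m)
  y≢0 : ¬ IsZero (c , z)
  y≢0 (n∣c , _) = <⇒≱ p^m<n (∣⇒≤ (subst (n ∣_) toℕc n∣c))
  timesPower : ∀ {A} → p ∣ A → n ∣ A * p ^ m
  timesPower (divides A′ refl) = divides A′ (*-assoc A′ p (p ^ m))
  annihilated : ∀ A → n ∣ A * 0
  annihilated A = subst (n ∣_) (sym (*-zeroʳ A)) (n ∣0)

-- For n = K·d, the points of Z_n[i] with both coordinates divisible by d are
-- the d·(s + t i) with s, t < K: a grid indexed by Fin K × Fin K, which we also
-- index by Fin (K·K) through combine/remQuot (the code of a grid point).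
module Grid {n K d : ℕ} .{{_ : NonZero d}} (n≡K*d : n ≡ K * d) where

  scale : Fin K → Fin n
  scale s = fromℕ< (subst (toℕ s * d <_) (sym n≡K*d) (*-monoˡ-< d (FP.toℕ<n s)))

  toℕ-scale : ∀ s → toℕ (scale s) ≡ toℕ s * d
  toℕ-scale s = FP.toℕ-fromℕ< _

  scale-injective : Injective _≡_ _≡_ scale
  scale-injective {s} {t} eq = FP.toℕ-injective (*-cancelʳ-≡ (toℕ s) (toℕ t) d
    (trans (sym (toℕ-scale s)) (trans (cong toℕ eq) (toℕ-scale t))))

  quotient<K : ∀ c (d∣c : d ∣ toℕ c) → quotient d∣c < K
  quotient<K c (divides q c≡q*d) = *-cancelʳ-< d q K (subst₂ _<_ c≡q*d n≡K*d (FP.toℕ<n c))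

  unscale : (c : Fin n) → d ∣ toℕ c → Fin K
  unscale c d∣c = fromℕ< (quotient<K c d∣c)

  scale-unscale : ∀ c (d∣c : d ∣ toℕ c) → scale (unscale c d∣c) ≡ c
  scale-unscale c d∣c = FP.toℕ-injective (begin
    toℕ (scale (unscale c d∣c))  ≡⟨ toℕ-scale (unscale c d∣c) ⟩
    toℕ (unscale c d∣c) * d      ≡⟨ cong (_* d) (FP.toℕ-fromℕ< (quotient<K c d∣c)) ⟩
    quotient d∣c * d             ≡⟨ _∣_.equality d∣c ⟨
    toℕ c                        ∎)

  grid : Fin K × Fin K → ZnI n
  grid (s , t) = scale s , scale t

  grid-injective : ∀ st st′ → grid st ≡ grid st′ → st ≡ st′
  grid-injective (s , t) (s′ , t′) eq =
    cong₂ _,_ (scale-injective (cong proj₁ eq)) (scale-injective (cong proj₂ eq))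

  grid-zero : ∀ s t → IsZero (grid (s , t)) → toℕ (combine s t) ≡ 0
  grid-zero s t (n∣sd , n∣td) = begin
    toℕ (combine s t)   ≡⟨ FP.toℕ-combine s t ⟩
    K * toℕ s + toℕ t   ≡⟨ cong₂ (λ u v → K * u + v) (vanish s n∣sd) (vanish t n∣td) ⟩
    K * 0 + 0           ≡⟨ cong (_+ 0) (*-zeroʳ K) ⟩
    0                   ∎
    where
    vanish : ∀ s → n ∣ toℕ (scale s) → toℕ s ≡ 0
    vanish s n∣sd = m*n≡0⇒m≡0 (toℕ s) d (trans (sym (toℕ-scale s)) (residueDivisible⇒zero (scale s) n∣sd))

  zero-grid : ∀ s t → toℕ (combine s t) ≡ 0 → IsZero (grid (s , t))
  zero-grid s t code≡0 = vanish s s≡0 , vanish t (m+n≡0⇒n≡0 (K * toℕ s) Ks+t≡0)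
    where
    Ks+t≡0 : K * toℕ s + toℕ t ≡ 0
    Ks+t≡0 = trans (sym (FP.toℕ-combine s t)) code≡0
    s≡0 : toℕ s ≡ 0
    s≡0 with m*n≡0⇒m≡0∨n≡0 K (m+n≡0⇒m≡0 (K * toℕ s) Ks+t≡0)
    ... | inj₁ K≡0 = ⊥-elim (n≮0 (subst (toℕ s <_) K≡0 (FP.toℕ<n s)))
    ... | inj₂ s≡0 = s≡0
    vanish : ∀ s → toℕ s ≡ 0 → n ∣ toℕ (scale s)
    vanish s s≡0 = subst (n ∣_) (sym (trans (toℕ-scale s) (cong (_* d) s≡0))) (n ∣0)

  code : (w : ZnI n) → d ∣ toℕ (proj₁ w) → d ∣ toℕ (proj₂ w) → Fin (K * K)
  code (c , c′) d∣c d∣c′ = combine (unscale c d∣c) (unscale c′ d∣c′)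

  grid-code : ∀ w d∣c d∣c′ → grid (remQuot K (code w d∣c d∣c′)) ≡ w
  grid-code (c , c′) d∣c d∣c′ = trans (cong grid (FP.remQuot-combine (unscale c d∣c) (unscale c′ d∣c′)))
    (cong₂ _,_ (scale-unscale c d∣c) (scale-unscale c′ d∣c′))

  -- Their successors on the cycle would be K² distinct nonzero grid
  -- points, but the grid has only K² points and contains 0.  Formally the
  -- codes of the successors define an injective map Fin K² → Fin K² that
  -- misses the code 0 of the origin.
  hamiltonianObstruction : ∀ {N} → 0 < K → HasOrder n N → HasCycle n N →
    (u : Fin K × Fin K → ZnI n) → (∀ st st′ → u st ≡ u st′ → st ≡ st′) → (∀ st → IsVertex (u st)) →
    (∀ st w → IsVertex w → MulZero (u st) w → d ∣ toℕ (proj₁ w) × d ∣ toℕ (proj₂ w)) → ⊥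
  hamiltonianObstruction 0<K order cycle u u-injective u-vertex neighbour-inGrid
    with hamiltonianSuccessor order cycle
  ... | next , next-adjacent , next-injective = proj₁ (w-vertex i) w-zero
    where
    pair : Fin (K * K) → Fin K × Fin K
    pair = remQuot {K} K
    w : Fin (K * K) → ZnI n
    w i = next (u (pair i)) (u-vertex (pair i))
    w-vertex : ∀ i → IsVertex (w i)
    w-vertex i = proj₁ (next-adjacent (u (pair i)) (u-vertex (pair i)))
    w-inGrid : ∀ i → d ∣ toℕ (proj₁ (w i)) × d ∣ toℕ (proj₂ (w i))
    w-inGrid i = neighbour-inGrid (pair i) (w i) (w-vertex i) (proj₂ (next-adjacent (u (pair i)) (u-vertex (pair i))))
    F : Fin (K * K) → Fin (K * K)
    F i = code (w i) (proj₁ (w-inGrid i)) (proj₂ (w-inGrid i))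
    decode : ∀ i → grid (pair (F i)) ≡ w i
    decode i = grid-code (w i) (proj₁ (w-inGrid i)) (proj₂ (w-inGrid i))
    F-injective : Injective _≡_ _≡_ F
    F-injective {i} {j} Fi≡Fj = begin
      i                         ≡⟨ FP.combine-remQuot {K} K i ⟨
      uncurry combine (pair i)  ≡⟨ cong (uncurry combine) same ⟩
      uncurry combine (pair j)  ≡⟨ FP.combine-remQuot {K} K j ⟩
      j                         ∎
      where
      same : pair i ≡ pair j
      same = u-injective (pair i) (pair j) (next-injective _ _ (u-vertex (pair i)) (u-vertex (pair j))
        (trans (sym (decode i)) (trans (cong (grid ∘ pair) Fi≡Fj) (decode j))))
    0<K² : 0 < K * K
    0<K² = *-mono-≤ 0<K 0<K
    origin : Fin (K * K)
    origin = fromℕ< 0<K²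
    i = proj₁ (injective⇒surjective F F-injective origin)
    Fi≡origin = proj₂ (injective⇒surjective F F-injective origin)
    w-zero : IsZero (w i)
    w-zero = subst IsZero (trans (cong (grid ∘ pair) (sym Fi≡origin)) (decode i))
      (zero-grid (proj₁ (pair origin)) (proj₂ (pair origin))
        (trans (cong toℕ (FP.combine-remQuot {K} K origin)) (FP.toℕ-fromℕ< 0<K²)))

module _ {r : ℕ} (pr : Prime (3 + r * 4)) where
  private
    p = 3 + r * 4

    1<p : 1 < p
    1<p = s≤s (s≤s z≤n)

    p∤1 : ¬ p ∣ 1
    p∤1 p∣1 with ∣⇒≤ p∣1
    ... | s≤s ()

    p∤2 : ¬ p ∣ 2
    p∤2 p∣2 with ∣⇒≤ p∣2
    ... | s≤s (s≤s ())

  -- -1 is not a square modulo a prime p ≡ 3 (mod 4): if t² ≡ -1 then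
  -- t^(p-1) = (t²)^(2r+1) ≡ -1, while Fermat gives t^(p-1) ≡ 1, so p ∣ 2.
  minusOneNonSquare : ∀ t → ¬ p ∣ t * t + 1
  minusOneNonSquare t p∣t²+1 = p∤2 (∣m+n∣m⇒∣n (subst (p ∣_) Kp+2 p∣[t^[p-1]+1]) (n∣m*n K))
    where
    p∤t : ¬ p ∣ t
    p∤t p∣t = p∤1 (∣m+n∣m⇒∣n p∣t²+1 (∣m⇒∣m*n t p∣t))
    K = proj₁ (fermatUnit pr t p∤t)
    t^[p-1]≡1+Kp : t ^ (2 + r * 4) ≡ 1 + K * p
    t^[p-1]≡1+Kp = proj₂ (fermatUnit pr t p∤t)
    t^[p-1]≡[t²]^[2r+1] : t ^ (2 + r * 4) ≡ (t * t) ^ (1 + r * 2)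
    t^[p-1]≡[t²]^[2r+1] = begin
      t ^ (2 + r * 4)          ≡⟨ cong (t ^_) (double r) ⟩
      t ^ (2 * (1 + r * 2))    ≡⟨ ^-*-assoc t 2 (1 + r * 2) ⟨
      (t ^ 2) ^ (1 + r * 2)    ≡⟨ cong (λ x → (t * x) ^ (1 + r * 2)) (*-identityʳ t) ⟩
      (t * t) ^ (1 + r * 2)    ∎
      where
      double : ∀ r → 2 + r * 4 ≡ 2 * (1 + r * 2)
      double = solve-∀
    p∣[t^[p-1]+1] : p ∣ t ^ (2 + r * 4) + 1
    p∣[t^[p-1]+1] = subst (λ x → p ∣ x + 1) (sym t^[p-1]≡[t²]^[2r+1]) (oddPower (t * t) r p∣t²+1)
    Kp+2 : t ^ (2 + r * 4) + 1 ≡ K * p + 2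
    Kp+2 = trans (cong (_+ 1) t^[p-1]≡1+Kp) (trans (+-comm (1 + K * p) 1) (+-comm 2 (K * p)))

  -- A prime p ≡ 3 (mod 4) dividing a² + b² divides a: otherwise, with
  -- u = a^(p-2) the inverse of a, the number t = b·u satisfies
  -- a²(t² + 1) ≡ b² + a² ≡ 0, so t² ≡ -1.
  sumOfSquares : ∀ a b → p ∣ a * a + b * b → p ∣ a
  sumOfSquares a b p∣a²+b² = decidable-stable (p ∣? a) p∤a⇒⊥
    where
    p∤a⇒⊥ : ¬ ¬ p ∣ a
    p∤a⇒⊥ p∤a = minusOneNonSquare t
      (euclidˡ a _ pr p∤a (euclidˡ a _ pr p∤a (subst (p ∣_) (*-assoc a a (t * t + 1)) p∣a²[t²+1])))
      where
      u = a ^ (1 + r * 4)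
      t = b * u
      K = proj₁ (fermatUnit pr a p∤a)
      au≡1+Kp : a * u ≡ 1 + K * p
      au≡1+Kp = proj₂ (fermatUnit pr a p∤a)
      clearDenominator : ∀ a b u → a * a * ((b * u) * (b * u) + 1) ≡ (b * (a * u)) * (b * (a * u)) + a * a
      clearDenominator = solve-∀
      expand : ∀ a b K p → (b * (1 + K * p)) * (b * (1 + K * p)) + a * a ≡ (a * a + b * b) + b * b * K * (2 + K * p) * p
      expand = solve-∀
      p∣a²[t²+1] : p ∣ a * a * (t * t + 1)
      p∣a²[t²+1] = subst (p ∣_) (sym (begin
        a * a * (t * t + 1)                            ≡⟨ clearDenominator a b u ⟩
        (b * (a * u)) * (b * (a * u)) + a * a           ≡⟨ cong (λ x → (b * x) * (b * x) + a * a) au≡1+Kp ⟩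
        (b * (1 + K * p)) * (b * (1 + K * p)) + a * a   ≡⟨ expand a b K p ⟩
        (a * a + b * b) + b * b * K * (2 + K * p) * p   ∎))
        (∣m∣n⇒∣m+n p∣a²+b² (n∣m*n (b * b * K * (2 + K * p))))

  -- Every zero-divisor of Z_{p^m}[i] lies in the ideal (p): if x·y = 0 with
  -- y ≠ 0, the norm a² + b² of x = a + b i annihilates y, so p divides it
  -- (otherwise p^m ∣ y), and then p ∣ a and p ∣ b since p ≡ 3 (mod 4).
  vertex⇒divisible : ∀ m (x : ZnI (p ^ m)) → IsVertex x → p ∣ toℕ (proj₁ x) × p ∣ toℕ (proj₂ x)
  vertex⇒divisible m (a , b) (_ , (c , d) , y≢0 , xy-re , xy-im) = byNorm (p ∣? (A * A + B * B))
    where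
    A = toℕ a
    B = toℕ b
    annihilates = normAnnihilates A B (toℕ c) (toℕ d) (ℤ∣.∣ᵤ⇒∣ xy-re) (ℤ∣.∣ᵤ⇒∣ xy-im)
    byNorm : Dec (p ∣ A * A + B * B) → p ∣ A × p ∣ B
    byNorm (yes p∣norm) = sumOfSquares A B p∣norm , sumOfSquares B A (subst (p ∣_) (+-comm (A * A) (B * B)) p∣norm)
    byNorm (no p∤norm) = ⊥-elim (y≢0 (primePowerCancel m _ (toℕ c) pr p∤norm (proj₁ annihilates) ,
                                      primePowerCancel m _ (toℕ d) pr p∤norm (proj₂ annihilates)))

  noVertices : ∀ (x : ZnI (p ^ 1)) → ¬ IsVertex x
  noVertices x x-vertex = proj₁ x-vertex (asPower (proj₁ divisible) , asPower (proj₂ divisible))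
    where
    divisible = vertex⇒divisible 1 x x-vertex
    asPower : ∀ {A} → p ∣ A → p ^ 1 ∣ A
    asPower {A} = subst (_∣ A) (sym (*-identityʳ p))

  cancelSquare : ∀ k X → + (p ^ (3 + k)) ∣ᵤ (+ p ℤ.* + p) ℤ.* X → + p ∣ℤ X
  cancelSquare k X n∣p²X = ℤ∣.∣ᵤ⇒∣ (∣-trans (m∣m*n (p ^ k))
    (*-cancelˡ-∣ (p * p) (subst₂ _∣_ (sym (*-assoc p p (p ^ suc k)))
      (trans (ℤP.abs-* (+ p ℤ.* + p) X) (cong (_* ℤ.∣ X ∣) (ℤP.abs-* (+ p) (+ p)))) n∣p²X)))

  -- A neighbour w of a vertex x = p·z of Z_{p^(3+k)}[i], where z = α + β i is
  -- a unit (p ∤ α² + β²), is divisible by p²: w = p·w′ as w is a vertex, and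
  -- x·w = p²·(z·w′) ≡ 0 gives z·w′ ≡ 0 (mod p), so p ∣ (α² + β²)·w′ and p ∣ w′.
  neighbourOfUnitMultiple : ∀ k α β (x w : ZnI (p ^ (3 + k))) →
    toℕ (proj₁ x) ≡ p * α → toℕ (proj₂ x) ≡ p * β → ¬ p ∣ α * α + β * β →
    IsVertex w → MulZero x w → p * p ∣ toℕ (proj₁ w) × p * p ∣ toℕ (proj₂ w)
  neighbourOfUnitMultiple k α β (a , b) w@(c , d) a≡pα b≡pβ p∤norm w-vertex (xw-re , xw-im)
    with vertex⇒divisible (3 + k) w w-vertex
  ... | divides γ c≡γp , divides δ d≡δp =
    byP² c≡γp (euclidˡ _ γ pr p∤norm (proj₁ annihilates)) ,
    byP² d≡δp (euclidˡ _ δ pr p∤norm (proj₂ annihilates))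
    where
    embed : ∀ {u} x y → u ≡ x * y → + u ≡ + x ℤ.* + y
    embed x y u≡xy = trans (cong +_ u≡xy) (ℤP.pos-* x y)
    scaledRe : ∀ P a b g d → (P ℤ.* a) ℤ.* (g ℤ.* P) ℤ.- (P ℤ.* b) ℤ.* (d ℤ.* P) ≡ (P ℤ.* P) ℤ.* (a ℤ.* g ℤ.- b ℤ.* d)
    scaledRe = solve-∀ℤ
    scaledIm : ∀ P a b g d → (P ℤ.* a) ℤ.* (d ℤ.* P) ℤ.+ (P ℤ.* b) ℤ.* (g ℤ.* P) ≡ (P ℤ.* P) ℤ.* (a ℤ.* d ℤ.+ b ℤ.* g)
    scaledIm = solve-∀ℤ
    annihilates = normAnnihilates α β γ δ
      (cancelSquare k _ (subst (+ (p ^ (3 + k)) ∣ᵤ_)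
        (trans (cong₂ ℤ._-_ (cong₂ ℤ._*_ (embed p α a≡pα) (embed γ p c≡γp)) (cong₂ ℤ._*_ (embed p β b≡pβ) (embed δ p d≡δp)))
               (scaledRe (+ p) (+ α) (+ β) (+ γ) (+ δ))) xw-re))
      (cancelSquare k _ (subst (+ (p ^ (3 + k)) ∣ᵤ_)
        (trans (cong₂ ℤ._+_ (cong₂ ℤ._*_ (embed p α a≡pα) (embed δ p d≡δp)) (cong₂ ℤ._*_ (embed p β b≡pβ) (embed γ p c≡γp)))
               (scaledIm (+ p) (+ α) (+ β) (+ γ) (+ δ))) xw-im))
    byP² : ∀ {c γ} → c ≡ γ * p → p ∣ γ → p * p ∣ c
    byP² c≡γp (divides γ′ refl) = divides γ′ (trans c≡γp (*-assoc γ′ p p))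


  -- In Z_{p²}[i] the vertices are the points p·(s + t i) ≠ 0 with s, t < p,
  -- and any two of them multiply to a multiple of p², i.e. to 0: Γ is the
  -- complete graph on p² - 1 ≥ 8 vertices.
  module Square where
    open Grid {p ^ 2} {p} {p} (cong (p *_) (*-identityʳ p))

    -- p² - 1, written so that p · p = 1 + N holds by computation
    N : ℕ
    N = (2 + r * 4) + (2 + r * 4) * p

    3≤N : 3 ≤ N
    3≤N = s≤s (s≤s (≤-trans (s≤s z≤n) (m≤n+m ((2 + r * 4) * p) (r * 4))))

    enumerate : Fin N → ZnI (p ^ 2)
    enumerate i = grid (remQuot {p} p (F.suc i))

    enumerate-vertex : ∀ i → IsVertex (enumerate i)
    enumerate-vertex i = divisible⇒vertex 1<p 1 (enumerate i)
      (divides (toℕ s) (toℕ-scale s)) (divides (toℕ t) (toℕ-scale t))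
      (λ zero → 1+n≢0 (trans (cong toℕ (sym (FP.combine-remQuot {p} p (F.suc i)))) (grid-zero s t zero)))
      where
      s = proj₁ (remQuot {p} p (F.suc i))
      t = proj₂ (remQuot {p} p (F.suc i))

    enumerate-injective : Injective _≡_ _≡_ enumerate
    enumerate-injective {i} {j} eq = FP.suc-injective (begin
      F.suc i                                    ≡⟨ FP.combine-remQuot {p} p (F.suc i) ⟨
      uncurry combine (remQuot {p} p (F.suc i))  ≡⟨ cong (uncurry combine) (grid-injective (remQuot {p} p (F.suc i)) (remQuot {p} p (F.suc j)) eq) ⟩
      uncurry combine (remQuot {p} p (F.suc j))  ≡⟨ FP.combine-remQuot {p} p (F.suc j) ⟩
      F.suc j                                    ∎)

    -- a vertex lies in the grid, and its code is not 0 since it is nonzero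
    enumerate-onto : ∀ x → IsVertex x → ∃ λ i → enumerate i ≡ x
    enumerate-onto x x-vertex with code x p∣a p∣b | grid-code x p∣a p∣b
      where
      p∣a = proj₁ (vertex⇒divisible 2 x x-vertex)
      p∣b = proj₂ (vertex⇒divisible 2 x x-vertex)
    ... | F.zero | grid-0≡x = ⊥-elim (proj₁ x-vertex (subst IsZero grid-0≡x (zero-grid F.zero F.zero refl)))
    ... | F.suc i | grid-i≡x = i , grid-i≡x

    order : HasOrder (p ^ 2) N
    order = enumerate , enumerate-injective , enumerate-vertex , enumerate-onto

    allAdjacent : ∀ x y → IsVertex x → IsVertex y → MulZero x y
    allAdjacent x@(a , b) y@(c , d) x-vertex y-vertex =
      productsDivisible⇒mulZero a b c d (p²∣ p∣a p∣c) (p²∣ p∣b p∣d) (p²∣ p∣a p∣d) (p²∣ p∣b p∣c)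
      where
      p∣a = proj₁ (vertex⇒divisible 2 x x-vertex)
      p∣b = proj₂ (vertex⇒divisible 2 x x-vertex)
      p∣c = proj₁ (vertex⇒divisible 2 y y-vertex)
      p∣d = proj₂ (vertex⇒divisible 2 y y-vertex)
      p²∣ : ∀ {u v} → p ∣ u → p ∣ v → p ^ 2 ∣ u * v
      p²∣ {u} {v} p∣u p∣v = subst (_∣ u * v) (cong (p *_) (sym (*-identityʳ p))) (*-pres-∣ p∣u p∣v)

    pancyclic : Pancyclic (p ^ 2)
    pancyclic = completePancyclic order 3≤N allAdjacent

  -- With K = p^(1+k)
  -- (so p^m = K·p²), the K² vertices u(s, t) = p·((1 + p s) + p t i), s, t < K,
  -- have only neighbours divisible by p², and there are just K² - 1 nonzero
  -- such elements; yet a Hamiltonian cycle gives each u(s, t) its own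
  -- successor, one of these neighbours.
  module HigherPower (k : ℕ) where
    K n : ℕ
    K = p ^ suc k
    n = p ^ (3 + k)

    n≡K*p² : n ≡ K * (p * p)
    n≡K*p² = reorder p K
      where
      reorder : ∀ p K → p * (p * K) ≡ K * (p * p)
      reorder = solve-∀

    open Grid {n} {K} {p * p} n≡K*p²

    -- u(s, t) = p·(α s + β t · i)
    α β : Fin K → ℕ
    α s = 1 + p * toℕ s
    β t = p * toℕ t

    pα<n : ∀ s → p * α s < n
    pα<n s = *-monoʳ-< p (<-≤-trans (+-monoˡ-< (p * toℕ s) 1<p)
      (subst (_≤ p * K) (*-suc p (toℕ s)) (*-monoʳ-≤ p (FP.toℕ<n s))))

    pβ<n : ∀ t → p * β t < n
    pβ<n t = *-monoʳ-< p (*-monoʳ-< p (FP.toℕ<n t))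

    u : Fin K × Fin K → ZnI n
    u (s , t) = fromℕ< (pα<n s) , fromℕ< (pβ<n t)

    u-injective : ∀ st st′ → u st ≡ u st′ → st ≡ st′
    u-injective (s , t) (s′ , t′) eq = cong₂ _,_
      (FP.toℕ-injective (*-cancelˡ-≡ (toℕ s) (toℕ s′) p (suc-injective (*-cancelˡ-≡ (α s) (α s′) p
        (trans (sym (FP.toℕ-fromℕ< (pα<n s))) (trans (cong (toℕ ∘ proj₁) eq) (FP.toℕ-fromℕ< (pα<n s′))))))))
      (FP.toℕ-injective (*-cancelˡ-≡ (toℕ t) (toℕ t′) p (*-cancelˡ-≡ (β t) (β t′) p
        (trans (sym (FP.toℕ-fromℕ< (pβ<n t))) (trans (cong (toℕ ∘ proj₂) eq) (FP.toℕ-fromℕ< (pβ<n t′)))))))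

    u-vertex : ∀ st → IsVertex (u st)
    u-vertex (s , t) = divisible⇒vertex 1<p (2 + k) (u (s , t))
      (subst (p ∣_) (sym (FP.toℕ-fromℕ< (pα<n s))) (m∣m*n (α s)))
      (subst (p ∣_) (sym (FP.toℕ-fromℕ< (pβ<n t))) (m∣m*n (β t)))
      (λ (n∣pα , _) → <⇒≱ (pα<n s) (∣⇒≤ (subst (n ∣_) (FP.toℕ-fromℕ< (pα<n s)) n∣pα)))

    -- α s + β t · i is a unit: its norm is ≡ 1 (mod p)
    unit : ∀ s t → ¬ p ∣ α s * α s + β t * β t
    unit s t p∣norm = p∤1 (∣m+n∣m⇒∣n (subst (p ∣_) (expand (toℕ s) (toℕ t) p) p∣norm) (n∣m*n (2 * toℕ s + p * (toℕ s * toℕ s + toℕ t * toℕ t))))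
      where
      expand : ∀ s t p → (1 + p * s) * (1 + p * s) + (p * t) * (p * t) ≡ (2 * s + p * (s * s + t * t)) * p + 1
      expand = solve-∀

    neighbour-divisible : ∀ st w → IsVertex w → MulZero (u st) w →
      p * p ∣ toℕ (proj₁ w) × p * p ∣ toℕ (proj₂ w)
    neighbour-divisible (s , t) w = neighbourOfUnitMultiple k (α s) (β t) (u (s , t)) w
      (FP.toℕ-fromℕ< (pα<n s)) (FP.toℕ-fromℕ< (pβ<n t)) (unit s t)

    noHamiltonianCycle : ∀ {N} → HasOrder n N → ¬ HasCycle n N
    noHamiltonianCycle order cycle =
      hamiltonianObstruction (m^n>0 p (suc k)) order cycle u u-injective u-vertex neighbour-divisible

  pancyclic⇔square : ∀ m → 1 ≤ m → (Pancyclic (p ^ m) ⇔ m ≡ 2)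
  pancyclic⇔square m 1≤m = mk⇔ (onlySquare m 1≤m) (λ { refl → Square.pancyclic })
    where
    onlySquare : ∀ m → 1 ≤ m → Pancyclic (p ^ m) → m ≡ 2
    onlySquare 1 _ (N , (e , _ , e-vertex , _) , 3≤N , _) =
      ⊥-elim (noVertices (e first) (e-vertex first))
      where
      first : Fin N
      first = fromℕ< (<-≤-trans z<s 3≤N)
    onlySquare 2 _ _ = refl
    onlySquare (suc (suc (suc k))) _ (N , order , 3≤N , cycles) =
      ⊥-elim (HigherPower.noHamiltonianCycle k order (cycles N 3≤N ≤-refl))

theorem2p2 : (q m : ℕ) → Prime q → q % 4 ≡ 3 → 1 ≤ m →
    (Pancyclic (q ^ m) ⇔ m ≡ 2)
theorem2p2 q m q-prime q%4≡3 1≤m =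
  subst (λ q → Prime q → Pancyclic (q ^ m) ⇔ m ≡ 2) (sym q≡3+4r)
    (λ pr → pancyclic⇔square {q / 4} pr m 1≤m) q-prime
  where
  q≡3+4r : q ≡ 3 + (q / 4) * 4
  q≡3+4r = trans (m≡m%n+[m/n]*n q 4) (cong (_+ (q / 4) * 4) q%4≡3)
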